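{- Let $(K,E)$ be an o-minimal $\mathrm{EXP}$-field and let $B\subseteq K$ be any subset. Then the exponential algebraic closure $\mathrm{ecl}^{E}_K(B)$ is a subfield of $K$ that is exponentially closed in $(K,E)$, i.e. the restriction of $E$ to $\mathrm{ecl}^{E}_K(B)$ is an order-preserving isomorphism from $(\mathrm{ecl}^{E}_K(B),+,0,<)$ onto $(\mathrm{ecl}^{E}_K(B)^{>0},\cdot,1,<)$.
   Context: An ordered exponential field $(K,E)$ is an ordered field $K$ together with an exponential $E$, i.e. an order-preserving isomorphism from the ordered additive group $(K,+,0,<)$ onto the ordered multiplicative group $(K^{>0},\cdot,1,<)$; it is viewed as a structure in the language $\mathcal{L}_{\exp}=\{+,-,\cdot,0,1,<,E\}$. It is an $\mathrm{EXP}$-field if $E$ satisfies the first-order sentence expressing the differential equation $E'=E$ (i.e. for every $x$, $(E(x+h)-E(x))/h\to E(x)$ as $h\to 0$). It is o-minimal if every subset of $K$ definable (with parameters) in this $\mathcal{L}_{\exp}$-structure is a finite union of points and open intervals. A subring $A\subseteq K$ is an $E$-ring if $E(a)\in A$ for all $a\in A$. For an $E$-ring $A$, $A[x_1,\dots,x_n]^{E}$ denotes the ring of exponential polynomials: the smallest ring containing $A[x_1,\dots,x_n]$ and closed under applying $E$ (elements are terms built from elements of $A$ and the variables using $+,-,\cdot$ and $E$, evaluated in $K$; partial derivatives obey $\partial E(f)/\partial x_i=E(f)\,\partial f/\partial x_i$). For $f_1,\dots,f_n\in A[x_1,\dots,x_n]^{E}$, the Khovanskii system of $f_1,\dots,f_n$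 over $A$ is the system $f_1(\underline{x})=\dots=f_n(\underline{x})=0$ and $\det J_{f_1,\dots,f_n}(\underline{x})\neq 0$, where $J$ is the Jacobian matrix $(\partial f_i/\partial x_j)_{i,j}$. For $B\subseteq K$, let $A$ be the smallest $E$-ring containing $B$; an element $a_1\in K$ is exponentially algebraic over $B$ if for some $n\in\mathbb{N}$ there are a Khovanskii system $S(x_1,\dots,x_n)$ over $A$ and $a_2,\dots,a_n\in K$ such that $(a_1,\dots,a_n)$ solves $S$. The exponential algebraic closure $\mathrm{ecl}^{E}_K(B)$ is the set of all elements of $K$ exponentially algebraic over $B$. A subfield $F\subseteq K$ is exponentially closed in $(K,E)$ if $E|_F$ is an exponential on $F$. -}

module Defs where

open import Data.Nat using (ℕ; zero; suc)
open import Data.Fin using (Fin; zero; suc; punchIn; _≟_)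
open import Data.Vec using (Vec; []; _∷_; lookup)
open import Data.List using (List)
open import Data.List.Relation.Unary.Any using (Any)
open import Data.Maybe using (Maybe; just; nothing)
open import Data.Product using (Σ; ∃; _×_; _,_)
open import Data.Sum using (_⊎_)
open import Data.Unit using (⊤)
open import Relation.Nullary using (¬_; yes; no)
open import Relation.Binary.PropositionalEquality using (_≡_)

record OrderedField : Set₁ where
  infixl 6 _+_ _-_
  infixl 7 _*_
  infix 4 _<_
  field
    K     : Set
    0#    : K
    1#    : K
    _+_   : K → K → K
    _*_   : K → K → K
    -_    : K → K
    inv   : (x : K) → ¬ (x ≡ 0#) → K
    _<_   : K → K → Set
    +-assoc   : ∀ x y z → (x + y) + z ≡ x + (y + z)
    +-comm    : ∀ x y → x + y ≡ y + x
    +-identity : ∀ x → 0# + x ≡ x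
    +-inverse : ∀ x → (- x) + x ≡ 0#
    *-assoc   : ∀ x y z → (x * y) * z ≡ x * (y * z)
    *-comm    : ∀ x y → x * y ≡ y * x
    *-identity : ∀ x → 1# * x ≡ x
    distrib   : ∀ x y z → x * (y + z) ≡ (x * y) + (x * z)
    0≢1       : ¬ (0# ≡ 1#)
    inv-left  : ∀ x (p : ¬ (x ≡ 0#)) → inv x p * x ≡ 1#
    <-irrefl  : ∀ x → ¬ (x < x)
    <-trans   : ∀ x y z → x < y → y < z → x < z
    <-tri     : ∀ x y → x < y ⊎ (x ≡ y ⊎ y < x)
    +-mono-<  : ∀ x y z → x < y → x + z < y + z
    *-pos     : ∀ x y → 0# < x → 0# < y → 0# < x * y

  _-_ : K → K → K
  x - y = x + (- y)

module _ (F : OrderedField) where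
  open OrderedField F

  record IsExponential (E : K → K) : Set where
    field
      E-pos       : ∀ x → 0# < E x
      E-hom       : ∀ x y → E (x + y) ≡ E x * E y
      E-mono      : ∀ x y → x < y → E x < E y
      E-surj      : ∀ y → 0# < y → ∃ λ x → E x ≡ y

  -- EXP axiom: E' = E, i.e. for all x,
  --   (E(x+h) - E(x)) / h → E(x) as h → 0.
  IsEXP : (E : K → K) → Set
  IsEXP E = ∀ x ε → 0# < ε → Σ K λ δ → (0# < δ) ×
    (∀ h → (h≢0 : ¬ (h ≡ 0#)) → (- δ) < h → h < δ →
       let q = (E (x + h) - E x) * inv h h≢0 in
       ((- ε) < (q - E x)) × ((q - E x) < ε))

  data Term (n : ℕ) : Set where
    var  : Fin n → Term n
    par  : K → Term n
    zer one : Term n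
    add mul : Term n → Term n → Term n
    neg  : Term n → Term n
    ex   : Term n → Term n

  evalT : (E : K → K) → ∀ {n} → Term n → Vec K n → K
  evalT E (var i) ρ = lookup ρ i
  evalT E (par a) ρ = a
  evalT E zer ρ = 0#
  evalT E one ρ = 1#
  evalT E (add s t) ρ = evalT E s ρ + evalT E t ρ
  evalT E (mul s t) ρ = evalT E s ρ * evalT E t ρ
  evalT E (neg t) ρ = - evalT E t ρ
  evalT E (ex t) ρ = E (evalT E t ρ)

  data Formula : ℕ → Set where
    eqF ltF : ∀ {n} → Term n → Term n → Formula n
    notF    : ∀ {n} → Formula n → Formula n
    andF orF impF : ∀ {n} → Formula n → Formula n → Formula n
    exF allF : ∀ {n} → Formula (suc n) → Formula n

  Sat : (E : K → K) → ∀ {n} → Formula n → Vec K n → Set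
  Sat E (eqF s t) ρ = evalT E s ρ ≡ evalT E t ρ
  Sat E (ltF s t) ρ = evalT E s ρ < evalT E t ρ
  Sat E (notF φ) ρ = ¬ Sat E φ ρ
  Sat E (andF φ ψ) ρ = Sat E φ ρ × Sat E ψ ρ
  Sat E (orF φ ψ) ρ = Sat E φ ρ ⊎ Sat E ψ ρ
  Sat E (impF φ ψ) ρ = Sat E φ ρ → Sat E ψ ρ
  Sat E (exF φ) ρ = Σ K λ x → Sat E φ (x ∷ ρ)
  Sat E (allF φ) ρ = (x : K) → Sat E φ (x ∷ ρ)

  -- A point, or an open interval with endpoints in K ∪ {-∞,+∞}
  -- (nothing = -∞ for the lower, +∞ for the upper endpoint).
  data Piece : Set where
    point    : K → Piece
    interval : Maybe K → Maybe K → Piece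

  LowerOK : Maybe K → K → Set
  LowerOK nothing x = ⊤
  LowerOK (just a) x = a < x

  UpperOK : Maybe K → K → Set
  UpperOK nothing x = ⊤
  UpperOK (just b) x = x < b

  InPiece : K → Piece → Set
  InPiece x (point a) = x ≡ a
  InPiece x (interval lo hi) = LowerOK lo x × UpperOK hi x

  OMinimal : (E : K → K) → Set
  OMinimal E = (φ : Formula 1) → Σ (List Piece) λ ps →
    ∀ x → (Sat E φ (x ∷ []) → Any (InPiece x) ps) ×
          (Any (InPiece x) ps → Sat E φ (x ∷ []))

  data ERing (E : K → K) (B : K → Set) : K → Set where
    base : ∀ {b} → B b → ERing E B b
    zero∈ : ERing E B 0#
    one∈  : ERing E B 1#
    add∈  : ∀ {a b} → ERing E B a → ERing E B b → ERing E B (a + b)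
    mul∈  : ∀ {a b} → ERing E B a → ERing E B b → ERing E B (a * b)
    neg∈  : ∀ {a} → ERing E B a → ERing E B (- a)
    exp∈  : ∀ {a} → ERing E B a → ERing E B (E a)

  data ExpPoly (A : K → Set) (n : ℕ) : Set where
    cst  : (a : K) → A a → ExpPoly A n
    x    : Fin n → ExpPoly A n
    _⊕_ _⊖_ _⊗_ : ExpPoly A n → ExpPoly A n → ExpPoly A n
    exP  : ExpPoly A n → ExpPoly A n

  evalP : (E : K → K) → ∀ {A n} → ExpPoly A n → (Fin n → K) → K
  evalP E (cst a _) ρ = a
  evalP E (x i) ρ = ρ i
  evalP E (f ⊕ g) ρ = evalP E f ρ + evalP E g ρ
  evalP E (f ⊖ g) ρ = evalP E f ρ - evalP E g ρ
  evalP E (f ⊗ g) ρ = evalP E f ρ * evalP E g ρ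
  evalP E (exP f) ρ = E (evalP E f ρ)

  evalD : (E : K → K) → ∀ {A n} → ExpPoly A n → Fin n → (Fin n → K) → K
  evalD E (cst a _) j ρ = 0#
  evalD E (x i) j ρ with i ≟ j
  ... | yes _ = 1#
  ... | no _  = 0#
  evalD E (f ⊕ g) j ρ = evalD E f j ρ + evalD E g j ρ
  evalD E (f ⊖ g) j ρ = evalD E f j ρ - evalD E g j ρ
  evalD E (f ⊗ g) j ρ = (evalD E f j ρ * evalP E g ρ) + (evalP E f ρ * evalD E g j ρ)
  evalD E (exP f) j ρ = E (evalP E f ρ) * evalD E f j ρ

  sumFin : ∀ n → (Fin n → K) → K
  sumFin zero f = 0#
  sumFin (suc n) f = f zero + sumFin n (λ i → f (suc i))

  sign : ∀ {n} → Fin n → K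
  sign zero = 1#
  sign (suc i) = - sign i

  det : ∀ n → (Fin n → Fin n → K) → K
  det zero M = 1#
  det (suc n) M = sumFin (suc n) λ j →
    (sign j * M zero j) * det n (λ r c → M (suc r) (punchIn j c))

  SolvesKhovanskii : (E : K → K) → ∀ {A n} → (Fin n → ExpPoly A n) → (Fin n → K) → Set
  SolvesKhovanskii E {n = n} f ρ =
    (∀ i → evalP E (f i) ρ ≡ 0#) ×
    ¬ (det n (λ i j → evalD E (f i) j ρ) ≡ 0#)

  ecl : (E : K → K) → (B : K → Set) → K → Set
  ecl E B a₁ = Σ ℕ λ m → Σ (Fin (suc m) → ExpPoly (ERing E B) (suc m)) λ f →
    Σ (Fin (suc m) → K) λ ρ → (ρ zero ≡ a₁) × SolvesKhovanskii E f ρ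

  record IsSubfield (S : K → Set) : Set where
    field
      0∈ : S 0#
      1∈ : S 1#
      +∈ : ∀ {a b} → S a → S b → S (a + b)
      *∈ : ∀ {a b} → S a → S b → S (a * b)
      -∈ : ∀ {a} → S a → S (- a)
      inv∈ : ∀ {a} (p : ¬ (a ≡ 0#)) → S a → S (inv a p)

  record IsExpClosed (E : K → K) (S : K → Set) : Set where
    field
      E∈    : ∀ {a} → S a → S (E a)
      E-pos : ∀ {a} → S a → 0# < E a
      E-hom : ∀ {a b} → S a → S b → E (a + b) ≡ E a * E b
      E-mono : ∀ {a b} → S a → S b → a < b → E a < E b
      E-surj : ∀ {y} → S y → 0# < y → Σ K λ a → S a × (E a ≡ y)

-- If a and b are exponentially algebraic over B, witnessed by Khovanskii systems f and g, and
-- c satisfies h(c, a, b) = 0 with ∂h/∂c ≠ 0 for an exponential polynomial h, then h placed on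
-- top of the disjoint union of f and g is a Khovanskii system solved by c and the witnesses:
-- its Jacobian is block triangular with determinant ∂h/∂c · det J_f · det J_g ≠ 0.
-- Sums, products, negatives, inverses, E and logarithms of positive elements are all defined
-- implicitly in this way, e.g. c − (a + b), c·a − 1, c − E(a), E(c) − a.
module Submission where

open import Defs
open import Data.Nat as ℕ using (ℕ; zero; suc; z≤n; s≤s)
import Data.Nat.Properties as ℕₚ
open import Data.Fin using (Fin; zero; suc; toℕ; punchIn; _↑ˡ_; _↑ʳ_; splitAt; reduce≥; _≟_)
open import Data.Fin.Properties using (toℕ-↑ʳ; toℕ<n; suc-injective; ↑ˡ-injective; ↑ʳ-injective)
open import Data.Vec.Functional using ([]; _∷_; _++_)
open import Data.Vec.Functional.Properties using (lookup-++ˡ; lookup-++ʳ; lookup-++-≥)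
open import Data.Product using (_×_; _,_)
open import Data.Empty using (⊥-elim)
open import Data.Sum using (inj₁; inj₂)
open import Relation.Nullary using (¬_; yes; no)
open import Relation.Binary.PropositionalEquality
  using (_≡_; refl; sym; trans; cong; cong₂; subst; module ≡-Reasoning)

toℕ-punchIn-≤ : ∀ {n} (j : Fin (suc n)) (c : Fin n) → toℕ (punchIn j c) ℕ.≤ suc (toℕ c)
toℕ-punchIn-≤ zero    c       = ℕₚ.≤-refl
toℕ-punchIn-≤ (suc j) zero    = z≤n
toℕ-punchIn-≤ (suc j) (suc c) = s≤s (toℕ-punchIn-≤ j c)

toℕ-punchIn-< : ∀ {n} (j : Fin (suc n)) (c : Fin n) → toℕ c ℕ.< toℕ j → toℕ (punchIn j c) ≡ toℕ c
toℕ-punchIn-< (suc j) zero    _         = refl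
toℕ-punchIn-< (suc j) (suc c) (s≤s c<j) = cong suc (toℕ-punchIn-< j c c<j)

punchIn-↑ˡ : ∀ {m} d (j : Fin (suc m)) (c : Fin m) → punchIn (j ↑ˡ d) (c ↑ˡ d) ≡ punchIn j c ↑ˡ d
punchIn-↑ˡ d zero    c       = refl
punchIn-↑ˡ d (suc j) zero    = refl
punchIn-↑ˡ d (suc j) (suc c) = cong suc (punchIn-↑ˡ d j c)

punchIn-↑ˡ-↑ʳ : ∀ {m d} (j : Fin (suc m)) (c : Fin d) → punchIn (j ↑ˡ d) (m ↑ʳ c) ≡ suc m ↑ʳ c
punchIn-↑ˡ-↑ʳ         zero    c = refl
punchIn-↑ˡ-↑ʳ {suc m} (suc j) c = cong suc (punchIn-↑ˡ-↑ʳ j c)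

m≤toℕ[m↑ʳi] : ∀ m {n} (i : Fin n) → m ℕ.≤ toℕ (m ↑ʳ i)
m≤toℕ[m↑ʳi] m i = subst (m ℕ.≤_) (sym (toℕ-↑ʳ m i)) (ℕₚ.m≤m+n m (toℕ i))

module FieldProperties (F : OrderedField) where
  open OrderedField F
  open ≡-Reasoning

  +-identityʳ : ∀ a → a + 0# ≡ a
  +-identityʳ a = trans (+-comm a 0#) (+-identity a)

  +-inverseʳ : ∀ a → a + (- a) ≡ 0#
  +-inverseʳ a = trans (+-comm a (- a)) (+-inverse a)

  *-identityʳ : ∀ a → a * 1# ≡ a
  *-identityʳ a = trans (*-comm a 1#) (*-identity a)

  0<x⇒x≢0 : ∀ {a} → 0# < a → ¬ (a ≡ 0#)
  0<x⇒x≢0 {a} 0<a a≡0 = <-irrefl 0# (subst (0# <_) a≡0 0<a)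

  x≡x+x⇒x≡0 : ∀ a → a ≡ a + a → a ≡ 0#
  x≡x+x⇒x≡0 a a≡a+a = sym (begin
    0#              ≡⟨ sym (+-inverse a) ⟩
    (- a) + a       ≡⟨ cong ((- a) +_) a≡a+a ⟩
    (- a) + (a + a) ≡⟨ sym (+-assoc (- a) a a) ⟩
    ((- a) + a) + a ≡⟨ cong (_+ a) (+-inverse a) ⟩
    0# + a          ≡⟨ +-identity a ⟩
    a               ∎)

  zeroʳ : ∀ a → a * 0# ≡ 0#
  zeroʳ a = x≡x+x⇒x≡0 (a * 0#)
    (trans (cong (a *_) (sym (+-identity 0#))) (distrib a 0# 0#))

  zeroˡ : ∀ a → 0# * a ≡ 0#
  zeroˡ a = trans (*-comm 0# a) (zeroʳ a)

  -0#≡0# : - 0# ≡ 0#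
  -0#≡0# = trans (sym (+-identityʳ (- 0#))) (+-inverse 0#)

  x-0#≡x : ∀ a → a - 0# ≡ a
  x-0#≡x a = trans (cong (a +_) -0#≡0#) (+-identityʳ a)

  distribʳ : ∀ a b c → (a + b) * c ≡ (a * c) + (b * c)
  distribʳ a b c =
    trans (*-comm (a + b) c) (trans (distrib c a b) (cong₂ _+_ (*-comm c a) (*-comm c b)))

  1≢0 : ¬ (1# ≡ 0#)
  1≢0 1≡0 = 0≢1 (sym 1≡0)

  *-nonZero : ∀ {a b} → ¬ (a ≡ 0#) → ¬ (b ≡ 0#) → ¬ (a * b ≡ 0#)
  *-nonZero {a} {b} a≢0 b≢0 ab≡0 = b≢0 (begin
    b                   ≡⟨ sym (*-identity b) ⟩
    1# * b              ≡⟨ cong (_* b) (sym (inv-left a a≢0)) ⟩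
    (inv a a≢0 * a) * b ≡⟨ *-assoc (inv a a≢0) a b ⟩
    inv a a≢0 * (a * b) ≡⟨ cong (inv a a≢0 *_) ab≡0 ⟩
    inv a a≢0 * 0#      ≡⟨ zeroʳ (inv a a≢0) ⟩
    0#                  ∎)

  x-y≢0 : ∀ {a b} → ¬ (a ≡ 0#) → b ≡ 0# → ¬ (a - b ≡ 0#)
  x-y≢0 {a} a≢0 b≡0 a-b≡0 = a≢0 (trans (sym (x-0#≡x a)) (trans (cong (λ t → a - t) (sym b≡0)) a-b≡0))

module Determinant (F : OrderedField) where
  open OrderedField F
  open FieldProperties F
  open ≡-Reasoning

  Matrix : ℕ → Set
  Matrix n = Fin n → Fin n → K

  minor : ∀ {n} → Matrix (suc n) → Fin (suc n) → Matrix n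
  minor M j r c = M (suc r) (punchIn j c)

  cofactorTerm : ∀ {n} → Matrix (suc n) → Fin (suc n) → K
  cofactorTerm {n} M j = (sign F j * M zero j) * det F n (minor M j)

  upperLeft : ∀ a d → Matrix (a ℕ.+ d) → Matrix a
  upperLeft a d M r c = M (r ↑ˡ d) (c ↑ˡ d)

  lowerRight : ∀ a d → Matrix (a ℕ.+ d) → Matrix d
  lowerRight a d M r c = M (a ↑ʳ r) (a ↑ʳ c)

  ZeroBlock : ∀ {n} → ℕ → ℕ → Matrix n → Set
  ZeroBlock p q M = ∀ r c → p ℕ.≤ toℕ r → toℕ c ℕ.< q → M r c ≡ 0#

  sumFin-cong : ∀ n {f g : Fin n → K} → (∀ i → f i ≡ g i) → sumFin F n f ≡ sumFin F n g
  sumFin-cong zero    f≡g = refl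
  sumFin-cong (suc n) f≡g = cong₂ _+_ (f≡g zero) (sumFin-cong n (λ i → f≡g (suc i)))

  sumFin-≡0 : ∀ n {f : Fin n → K} → (∀ i → f i ≡ 0#) → sumFin F n f ≡ 0#
  sumFin-≡0 zero    f≡0 = refl
  sumFin-≡0 (suc n) f≡0 =
    trans (cong₂ _+_ (f≡0 zero) (sumFin-≡0 n (λ i → f≡0 (suc i)))) (+-identity 0#)

  sumFin-+ : ∀ m d (f : Fin (m ℕ.+ d) → K) →
    sumFin F (m ℕ.+ d) f ≡ sumFin F m (λ i → f (i ↑ˡ d)) + sumFin F d (λ i → f (m ↑ʳ i))
  sumFin-+ zero    d f = sym (+-identity _)
  sumFin-+ (suc m) d f =
    trans (cong (f zero +_) (sumFin-+ m d (λ i → f (suc i)))) (sym (+-assoc _ _ _))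

  sumFin-*ʳ : ∀ n (f : Fin n → K) c → sumFin F n (λ i → f i * c) ≡ sumFin F n f * c
  sumFin-*ʳ zero    f c = sym (zeroˡ c)
  sumFin-*ʳ (suc n) f c =
    trans (cong (f zero * c +_) (sumFin-*ʳ n (λ i → f (suc i)) c)) (sym (distribʳ _ _ c))

  sign-↑ˡ : ∀ {m} d (j : Fin m) → sign F (j ↑ˡ d) ≡ sign F j
  sign-↑ˡ d zero    = refl
  sign-↑ˡ d (suc j) = cong -_ (sign-↑ˡ d j)

  det-cong : ∀ n {M N : Matrix n} → (∀ r c → M r c ≡ N r c) → det F n M ≡ det F n N
  det-cong zero    M≡N = refl
  det-cong (suc n) M≡N = sumFin-cong (suc n) λ j →
    cong₂ _*_ (cong (sign F j *_) (M≡N zero j)) (det-cong n (λ r c → M≡N (suc r) (punchIn j c)))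

  det₁ : (M : Matrix 1) → det F 1 M ≡ M zero zero
  det₁ M = trans (+-identityʳ _) (trans (*-identityʳ _) (*-identity _))

  cofactorTerm-entry≡0 : ∀ {n} (M : Matrix (suc n)) j → M zero j ≡ 0# → cofactorTerm M j ≡ 0#
  cofactorTerm-entry≡0 {n} M j M₀ⱼ≡0 = begin
    (sign F j * M zero j) * D ≡⟨ cong (λ t → (sign F j * t) * D) M₀ⱼ≡0 ⟩
    (sign F j * 0#) * D       ≡⟨ cong (_* D) (zeroʳ (sign F j)) ⟩
    0# * D                    ≡⟨ zeroˡ D ⟩
    0#                        ∎
    where
    D : K
    D = det F n (minor M j)

  cofactorTerm-minor≡0 : ∀ {n} (M : Matrix (suc n)) j → det F n (minor M j) ≡ 0# → cofactorTerm M j ≡ 0#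
  cofactorTerm-minor≡0 M j detMinor≡0 =
    trans (cong ((sign F j * M zero j) *_) detMinor≡0) (zeroʳ _)

  -- The n ∸ p rows from p on live in the n ∸ q < n ∸ p columns from q on, so they are dependent.
  det-zeroBlock : ∀ n p q (M : Matrix n) → ZeroBlock p q M → p ℕ.< q → q ℕ.≤ n → det F n M ≡ 0#
  det-zeroBlock zero    _       zero    _ _ ()        _
  det-zeroBlock zero    _       (suc _) _ _ _         ()
  det-zeroBlock (suc n) (suc _) zero    _ _ ()        _
  det-zeroBlock (suc n) (suc p) (suc q) M Z (s≤s p<q) (s≤s q≤n) =
    sumFin-≡0 (suc n) λ j → cofactorTerm-minor≡0 M j (det-zeroBlock n p q (minor M j) (Z′ j) p<q q≤n)
    where
    Z′ : ∀ j → ZeroBlock p q (minor M j)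
    Z′ j r c p≤r c<q = Z (suc r) (punchIn j c) (s≤s p≤r) (ℕₚ.≤-<-trans (toℕ-punchIn-≤ j c) (s≤s c<q))
  det-zeroBlock (suc n) zero    q       M Z 0<q       q≤1+n = sumFin-≡0 (suc n) term≡0
    where
    term≡0 : ∀ j → cofactorTerm M j ≡ 0#
    term≡0 j with toℕ j ℕ.<? q
    ... | yes j<q = cofactorTerm-entry≡0 M j (Z zero j z≤n j<q)
    ... | no  j≮q = cofactorTerm-minor≡0 M j (det-zeroBlock n 0 q (minor M j) Z′ 0<q q≤n)
      where
      q≤j : q ℕ.≤ toℕ j
      q≤j = ℕₚ.≮⇒≥ j≮q
      q≤n : q ℕ.≤ n
      q≤n = ℕₚ.≤-trans q≤j (ℕₚ.≤-pred (toℕ<n j))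
      Z′ : ZeroBlock 0 q (minor M j)
      Z′ r c _ c<q = Z (suc r) (punchIn j c) z≤n
        (subst (ℕ._< q) (sym (toℕ-punchIn-< j c (ℕₚ.<-≤-trans c<q q≤j))) c<q)

  cofactorTerm-↑ʳ≡0 : ∀ a d (M : Matrix (suc a ℕ.+ d)) → ZeroBlock (suc a) (suc a) M →
    ∀ i → cofactorTerm M (suc a ↑ʳ i) ≡ 0#
  cofactorTerm-↑ʳ≡0 a d M Z i =
    cofactorTerm-minor≡0 M j (det-zeroBlock (a ℕ.+ d) a (suc a) (minor M j) Z′ ℕₚ.≤-refl 1+a≤a+d)
    where
    j : Fin (suc a ℕ.+ d)
    j = suc a ↑ʳ i
    1+a≤j : suc a ℕ.≤ toℕ j
    1+a≤j = m≤toℕ[m↑ʳi] (suc a) i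
    1+a≤a+d : suc a ℕ.≤ a ℕ.+ d
    1+a≤a+d = ℕₚ.≤-pred (ℕₚ.≤-<-trans 1+a≤j (toℕ<n j))
    Z′ : ZeroBlock a (suc a) (minor M j)
    Z′ r c a≤r c<1+a = Z (suc r) (punchIn j c) (s≤s a≤r)
      (subst (ℕ._< suc a) (sym (toℕ-punchIn-< j c (ℕₚ.<-≤-trans c<1+a 1+a≤j))) c<1+a)

  det-blockTriangular : ∀ a d (M : Matrix (a ℕ.+ d)) → ZeroBlock a a M →
    det F (a ℕ.+ d) M ≡ det F a (upperLeft a d M) * det F d (lowerRight a d M)
  det-blockTriangular zero    d M Z = sym (*-identity _)
  det-blockTriangular (suc a) d M Z = begin
    sumFin F (suc a ℕ.+ d) (cofactorTerm M)
      ≡⟨ sumFin-+ (suc a) d (cofactorTerm M) ⟩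
    sumFin F (suc a) (λ j → cofactorTerm M (j ↑ˡ d)) + sumFin F d (λ i → cofactorTerm M (suc a ↑ʳ i))
      ≡⟨ cong₂ _+_ (sumFin-cong (suc a) left-column) (sumFin-≡0 d (cofactorTerm-↑ʳ≡0 a d M Z)) ⟩
    sumFin F (suc a) (λ j → cofactorTerm A j * D) + 0#
      ≡⟨ +-identityʳ _ ⟩
    sumFin F (suc a) (λ j → cofactorTerm A j * D)
      ≡⟨ sumFin-*ʳ (suc a) (cofactorTerm A) D ⟩
    det F (suc a) A * D ∎
    where
    A : Matrix (suc a)
    A = upperLeft (suc a) d M
    D : K
    D = det F d (lowerRight (suc a) d M)
    left-column : ∀ j → cofactorTerm M (j ↑ˡ d) ≡ cofactorTerm A j * D
    left-column j = begin
      (sign F (j ↑ˡ d) * M zero (j ↑ˡ d)) * det F (a ℕ.+ d) (minor M (j ↑ˡ d))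
        ≡⟨ cong₂ _*_ (cong (_* A zero j) (sign-↑ˡ d j)) (det-blockTriangular a d (minor M (j ↑ˡ d)) Z′) ⟩
      (sign F j * A zero j) * (det F a (upperLeft a d (minor M (j ↑ˡ d)))
                                * det F d (lowerRight a d (minor M (j ↑ˡ d))))
        ≡⟨ cong₂ (λ u v → (sign F j * A zero j) * (u * v))
             (det-cong a (λ r c → cong (M (suc (r ↑ˡ d))) (punchIn-↑ˡ d j c)))
             (det-cong d (λ r c → cong (M (suc (a ↑ʳ r))) (punchIn-↑ˡ-↑ʳ j c))) ⟩
      (sign F j * A zero j) * (det F a (minor A j) * D)
        ≡⟨ sym (*-assoc _ _ _) ⟩
      cofactorTerm A j * D ∎
      where
      Z′ : ZeroBlock a a (minor M (j ↑ˡ d))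
      Z′ r c a≤r c<a = Z (suc r) _ (s≤s a≤r) (ℕₚ.≤-<-trans (toℕ-punchIn-≤ (j ↑ˡ d) c) (s≤s c<a))

module Renaming (F : OrderedField) (E : OrderedField.K F → OrderedField.K F) where
  open OrderedField F
  open FieldProperties F

  rename : ∀ {A : K → Set} {n n′} → (Fin n → Fin n′) → ExpPoly F A n → ExpPoly F A n′
  rename σ (cst a a∈A) = cst a a∈A
  rename σ (x i)       = x (σ i)
  rename σ (f ⊕ g)     = rename σ f ⊕ rename σ g
  rename σ (f ⊖ g)     = rename σ f ⊖ rename σ g
  rename σ (f ⊗ g)     = rename σ f ⊗ rename σ g
  rename σ (exP f)     = exP (rename σ f)

  evalP-cong : ∀ {A n} (f : ExpPoly F A n) {ρ τ : Fin n → K} → (∀ i → ρ i ≡ τ i) →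
    evalP F E f ρ ≡ evalP F E f τ
  evalP-cong (cst a _) ρ≡τ = refl
  evalP-cong (x i)     ρ≡τ = ρ≡τ i
  evalP-cong (f ⊕ g)   ρ≡τ = cong₂ _+_ (evalP-cong f ρ≡τ) (evalP-cong g ρ≡τ)
  evalP-cong (f ⊖ g)   ρ≡τ = cong₂ _-_ (evalP-cong f ρ≡τ) (evalP-cong g ρ≡τ)
  evalP-cong (f ⊗ g)   ρ≡τ = cong₂ _*_ (evalP-cong f ρ≡τ) (evalP-cong g ρ≡τ)
  evalP-cong (exP f)   ρ≡τ = cong E (evalP-cong f ρ≡τ)

  evalD-cong : ∀ {A n} (f : ExpPoly F A n) j {ρ τ : Fin n → K} → (∀ i → ρ i ≡ τ i) →
    evalD F E f j ρ ≡ evalD F E f j τ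
  evalD-cong (cst a _) j ρ≡τ = refl
  evalD-cong (x i)     j ρ≡τ = refl
  evalD-cong (f ⊕ g)   j ρ≡τ = cong₂ _+_ (evalD-cong f j ρ≡τ) (evalD-cong g j ρ≡τ)
  evalD-cong (f ⊖ g)   j ρ≡τ = cong₂ _-_ (evalD-cong f j ρ≡τ) (evalD-cong g j ρ≡τ)
  evalD-cong (f ⊗ g)   j ρ≡τ = cong₂ _+_ (cong₂ _*_ (evalD-cong f j ρ≡τ) (evalP-cong g ρ≡τ))
                                         (cong₂ _*_ (evalP-cong f ρ≡τ) (evalD-cong g j ρ≡τ))
  evalD-cong (exP f)   j ρ≡τ = cong₂ _*_ (cong E (evalP-cong f ρ≡τ)) (evalD-cong f j ρ≡τ)

  evalP-rename : ∀ {A n n′} (σ : Fin n → Fin n′) (f : ExpPoly F A n) (ρ : Fin n′ → K) →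
    evalP F E (rename σ f) ρ ≡ evalP F E f (λ i → ρ (σ i))
  evalP-rename σ (cst a _) ρ = refl
  evalP-rename σ (x i)     ρ = refl
  evalP-rename σ (f ⊕ g)   ρ = cong₂ _+_ (evalP-rename σ f ρ) (evalP-rename σ g ρ)
  evalP-rename σ (f ⊖ g)   ρ = cong₂ _-_ (evalP-rename σ f ρ) (evalP-rename σ g ρ)
  evalP-rename σ (f ⊗ g)   ρ = cong₂ _*_ (evalP-rename σ f ρ) (evalP-rename σ g ρ)
  evalP-rename σ (exP f)   ρ = cong E (evalP-rename σ f ρ)

  evalD-rename : ∀ {A n n′} (σ : Fin n → Fin n′) i → (∀ k → σ k ≡ σ i → k ≡ i) →
    (f : ExpPoly F A n) (ρ : Fin n′ → K) →
    evalD F E (rename σ f) (σ i) ρ ≡ evalD F E f i (λ k → ρ (σ k))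
  evalD-rename σ i inj (cst a _) ρ = refl
  evalD-rename σ i inj (x k)     ρ with σ k ≟ σ i | k ≟ i
  ... | yes _     | yes _   = refl
  ... | yes σk≡σi | no  k≢i = ⊥-elim (k≢i (inj k σk≡σi))
  ... | no  σk≢σi | yes k≡i = ⊥-elim (σk≢σi (cong σ k≡i))
  ... | no  _     | no  _   = refl
  evalD-rename σ i inj (f ⊕ g) ρ = cong₂ _+_ (evalD-rename σ i inj f ρ) (evalD-rename σ i inj g ρ)
  evalD-rename σ i inj (f ⊖ g) ρ = cong₂ _-_ (evalD-rename σ i inj f ρ) (evalD-rename σ i inj g ρ)
  evalD-rename σ i inj (f ⊗ g) ρ =
    cong₂ _+_ (cong₂ _*_ (evalD-rename σ i inj f ρ) (evalP-rename σ g ρ))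
              (cong₂ _*_ (evalP-rename σ f ρ) (evalD-rename σ i inj g ρ))
  evalD-rename σ i inj (exP f) ρ = cong₂ _*_ (cong E (evalP-rename σ f ρ)) (evalD-rename σ i inj f ρ)

  evalD-rename-∉ : ∀ {A n n′} (σ : Fin n → Fin n′) j → (∀ k → ¬ (σ k ≡ j)) →
    (f : ExpPoly F A n) (ρ : Fin n′ → K) → evalD F E (rename σ f) j ρ ≡ 0#
  evalD-rename-∉ σ j j∉σ (cst a _) ρ = refl
  evalD-rename-∉ σ j j∉σ (x k)     ρ with σ k ≟ j
  ... | yes σk≡j = ⊥-elim (j∉σ k σk≡j)
  ... | no  _    = refl
  evalD-rename-∉ σ j j∉σ (f ⊕ g) ρ =
    trans (cong₂ _+_ (evalD-rename-∉ σ j j∉σ f ρ) (evalD-rename-∉ σ j j∉σ g ρ)) (+-identity 0#)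
  evalD-rename-∉ σ j j∉σ (f ⊖ g) ρ =
    trans (cong₂ _-_ (evalD-rename-∉ σ j j∉σ f ρ) (evalD-rename-∉ σ j j∉σ g ρ)) (x-0#≡x 0#)
  evalD-rename-∉ σ j j∉σ (f ⊗ g) ρ =
    trans (cong₂ _+_ (trans (cong (_* _) (evalD-rename-∉ σ j j∉σ f ρ)) (zeroˡ _))
                     (trans (cong (_ *_) (evalD-rename-∉ σ j j∉σ g ρ)) (zeroʳ _)))
          (+-identity 0#)
  evalD-rename-∉ σ j j∉σ (exP f) ρ = trans (cong (_ *_) (evalD-rename-∉ σ j j∉σ f ρ)) (zeroʳ _)

module KhovanskiiSystems (F : OrderedField) (E : OrderedField.K F → OrderedField.K F) where
  open OrderedField F
  open FieldProperties F
  open Determinant F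
  open Renaming F E
  open ≡-Reasoning

  jacobian : ∀ {A n} → (Fin n → ExpPoly F A n) → (Fin n → K) → Matrix n
  jacobian f ρ i j = evalD F E (f i) j ρ

  juxtapose : ∀ {A m k} → (Fin m → ExpPoly F A m) → (Fin k → ExpPoly F A k) →
    Fin (m ℕ.+ k) → ExpPoly F A (m ℕ.+ k)
  juxtapose {m = m} {k} f g = (λ i → rename (_↑ˡ k) (f i)) ++ (λ i → rename (m ↑ʳ_) (g i))

  solves-[] : ∀ {A} → SolvesKhovanskii F E {A} {0} [] []
  solves-[] = (λ ()) , 1≢0

  solves-∷ : ∀ {A n} {f : Fin n → ExpPoly F A n} {ρ} (h : ExpPoly F A (suc n)) c →
    SolvesKhovanskii F E f ρ →
    evalP F E h (c ∷ ρ) ≡ 0# → ¬ (evalD F E h zero (c ∷ ρ) ≡ 0#) →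
    SolvesKhovanskii F E (h ∷ λ i → rename suc (f i)) (c ∷ ρ)
  solves-∷ {n = n} {f} {ρ} h c (f≡0 , detJf≢0) h≡0 ∂h≢0 = zeros , detJ≢0
    where
    J : Matrix (suc n)
    J = jacobian (h ∷ λ i → rename suc (f i)) (c ∷ ρ)
    zeros : ∀ i → evalP F E ((h ∷ λ i → rename suc (f i)) i) (c ∷ ρ) ≡ 0#
    zeros zero    = h≡0
    zeros (suc i) = trans (evalP-rename suc (f i) (c ∷ ρ)) (f≡0 i)
    lowerLeft≡0 : ZeroBlock 1 1 J
    lowerLeft≡0 (suc r) zero _ _ = evalD-rename-∉ suc zero (λ _ ()) (f r) (c ∷ ρ)
    lowerLeft≡0 (suc r) (suc c) _ (s≤s ())
    detJ≡ : det F (suc n) J ≡ evalD F E h zero (c ∷ ρ) * det F n (jacobian f ρ)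
    detJ≡ = trans (det-blockTriangular 1 n J lowerLeft≡0)
      (cong₂ _*_ (det₁ (upperLeft 1 n J)) (det-cong n λ r c′ →
        evalD-rename suc c′ (λ k → suc-injective) (f r) (c ∷ ρ)))
    detJ≢0 : ¬ (det F (suc n) J ≡ 0#)
    detJ≢0 detJ≡0 = *-nonZero ∂h≢0 detJf≢0 (trans (sym detJ≡) detJ≡0)

  solves-++ : ∀ {A m k} (f : Fin m → ExpPoly F A m) (ρ : Fin m → K)
                        (g : Fin k → ExpPoly F A k) (τ : Fin k → K) →
    SolvesKhovanskii F E f ρ → SolvesKhovanskii F E g τ →
    SolvesKhovanskii F E (juxtapose f g) (ρ ++ τ)
  solves-++ {A} {m} {k} f ρ g τ (f≡0 , detJf≢0) (g≡0 , detJg≢0) = zeros , detJ≢0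
    where
    zeros : ∀ i → evalP F E (juxtapose f g i) (ρ ++ τ) ≡ 0#
    zeros i with splitAt m i
    ... | inj₁ i′ = trans (evalP-rename (_↑ˡ k) (f i′) (ρ ++ τ))
                      (trans (evalP-cong (f i′) (lookup-++ˡ ρ τ)) (f≡0 i′))
    ... | inj₂ i′ = trans (evalP-rename (m ↑ʳ_) (g i′) (ρ ++ τ))
                      (trans (evalP-cong (g i′) (lookup-++ʳ ρ τ)) (g≡0 i′))
    f↑ : Fin m → ExpPoly F A (m ℕ.+ k)
    f↑ i = rename (_↑ˡ k) (f i)
    g↑ : Fin k → ExpPoly F A (m ℕ.+ k)
    g↑ i = rename (m ↑ʳ_) (g i)
    J : Matrix (m ℕ.+ k)
    J = jacobian (juxtapose f g) (ρ ++ τ)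
    lowerLeft≡0 : ZeroBlock m m J
    lowerLeft≡0 r c m≤r c<m = begin
      evalD F E (juxtapose f g r) c (ρ ++ τ)
        ≡⟨ cong (λ p → evalD F E p c (ρ ++ τ)) (lookup-++-≥ f↑ g↑ r m≤r) ⟩
      evalD F E (rename (m ↑ʳ_) (g (reduce≥ r m≤r))) c (ρ ++ τ)
        ≡⟨ evalD-rename-∉ (m ↑ʳ_) c c∉m↑ʳ (g (reduce≥ r m≤r)) (ρ ++ τ) ⟩
      0# ∎
      where
      c∉m↑ʳ : ∀ i → ¬ (m ↑ʳ i ≡ c)
      c∉m↑ʳ i m↑ʳi≡c = ℕₚ.<⇒≱ c<m (subst (λ j → m ℕ.≤ toℕ j) m↑ʳi≡c (m≤toℕ[m↑ʳi] m i))
    upperLeft≡ : ∀ r c → upperLeft m k J r c ≡ jacobian f ρ r c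
    upperLeft≡ r c = begin
      evalD F E (juxtapose f g (r ↑ˡ k)) (c ↑ˡ k) (ρ ++ τ)
        ≡⟨ cong (λ p → evalD F E p (c ↑ˡ k) (ρ ++ τ)) (lookup-++ˡ f↑ g↑ r) ⟩
      evalD F E (rename (_↑ˡ k) (f r)) (c ↑ˡ k) (ρ ++ τ)
        ≡⟨ evalD-rename (_↑ˡ k) c (λ i → ↑ˡ-injective k i c) (f r) (ρ ++ τ) ⟩
      evalD F E (f r) c (λ i → (ρ ++ τ) (i ↑ˡ k))
        ≡⟨ evalD-cong (f r) c (lookup-++ˡ ρ τ) ⟩
      evalD F E (f r) c ρ ∎
    lowerRight≡ : ∀ r c → lowerRight m k J r c ≡ jacobian g τ r c
    lowerRight≡ r c = begin
      evalD F E (juxtapose f g (m ↑ʳ r)) (m ↑ʳ c) (ρ ++ τ)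
        ≡⟨ cong (λ p → evalD F E p (m ↑ʳ c) (ρ ++ τ)) (lookup-++ʳ f↑ g↑ r) ⟩
      evalD F E (rename (m ↑ʳ_) (g r)) (m ↑ʳ c) (ρ ++ τ)
        ≡⟨ evalD-rename (m ↑ʳ_) c (λ i → ↑ʳ-injective m i c) (g r) (ρ ++ τ) ⟩
      evalD F E (g r) c (λ i → (ρ ++ τ) (m ↑ʳ i))
        ≡⟨ evalD-cong (g r) c (lookup-++ʳ ρ τ) ⟩
      evalD F E (g r) c τ ∎
    detJ≡ : det F (m ℕ.+ k) J ≡ det F m (jacobian f ρ) * det F k (jacobian g τ)
    detJ≡ = trans (det-blockTriangular m k J lowerLeft≡0)
                  (cong₂ _*_ (det-cong m upperLeft≡) (det-cong k lowerRight≡))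
    detJ≢0 : ¬ (det F (m ℕ.+ k) J ≡ 0#)
    detJ≢0 detJ≡0 = *-nonZero detJf≢0 detJg≢0 (trans (sym detJ≡) detJ≡0)

module ExponentialAlgebraicClosure (F : OrderedField) (E : OrderedField.K F → OrderedField.K F)
                                   (B : OrderedField.K F → Set) where
  open OrderedField F
  open FieldProperties F
  open Renaming F E
  open KhovanskiiSystems F E

  Poly : ℕ → Set
  Poly = ExpPoly F (ERing F E B)

  ecl-implicit : ∀ {n p} (f : Fin n → Poly n) (ρ : Fin n → K) → SolvesKhovanskii F E f ρ →
    (π : Fin p → Fin n) (as : Fin p → K) → (∀ i → ρ (π i) ≡ as i) →
    (h : Poly (suc p)) (c : K) →
    evalP F E h (c ∷ as) ≡ 0# → ¬ (evalD F E h zero (c ∷ as) ≡ 0#) → ecl F E B c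
  ecl-implicit {n} {p} f ρ sol π as ρπ≡as h c h≡0 ∂h≢0 =
    n , (h′ ∷ λ i → rename suc (f i)) , (c ∷ ρ) , refl , solves-∷ h′ c sol h′≡0 ∂h′≢0
    where
    σ : Fin (suc p) → Fin (suc n)
    σ = zero ∷ λ i → suc (π i)
    σ-injective-at-0 : ∀ k → σ k ≡ zero → k ≡ zero
    σ-injective-at-0 zero _ = refl
    σ-injective-at-0 (suc k) ()
    h′ : Poly (suc n)
    h′ = rename σ h
    coordinates : ∀ i → (c ∷ ρ) (σ i) ≡ (c ∷ as) i
    coordinates zero    = refl
    coordinates (suc i) = ρπ≡as i
    h′≡0 : evalP F E h′ (c ∷ ρ) ≡ 0#
    h′≡0 = trans (evalP-rename σ h (c ∷ ρ)) (trans (evalP-cong h coordinates) h≡0)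
    ∂h′≡∂h : evalD F E h′ zero (c ∷ ρ) ≡ evalD F E h zero (c ∷ as)
    ∂h′≡∂h = trans (evalD-rename σ zero σ-injective-at-0 h (c ∷ ρ)) (evalD-cong h zero coordinates)
    ∂h′≢0 : ¬ (evalD F E h′ zero (c ∷ ρ) ≡ 0#)
    ∂h′≢0 ∂h′≡0 = ∂h≢0 (trans (sym ∂h′≡∂h) ∂h′≡0)

  ecl-implicit₀ : (h : Poly 1) (c : K) →
    evalP F E h (c ∷ []) ≡ 0# → ¬ (evalD F E h zero (c ∷ []) ≡ 0#) → ecl F E B c
  ecl-implicit₀ = ecl-implicit [] [] solves-[] (λ ()) [] (λ ())

  ecl-implicit₁ : ∀ {a} → ecl F E B a → (h : Poly 2) (c : K) →
    evalP F E h (c ∷ a ∷ []) ≡ 0# → ¬ (evalD F E h zero (c ∷ a ∷ []) ≡ 0#) → ecl F E B c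
  ecl-implicit₁ {a} (_ , f , ρ , ρ₀≡a , sol) = ecl-implicit f ρ sol (λ _ → zero) (a ∷ []) coordinates
    where
    coordinates : ∀ i → ρ zero ≡ (a ∷ []) i
    coordinates zero = ρ₀≡a

  ecl-implicit₂ : ∀ {a b} → ecl F E B a → ecl F E B b → (h : Poly 3) (c : K) →
    evalP F E h (c ∷ a ∷ b ∷ []) ≡ 0# → ¬ (evalD F E h zero (c ∷ a ∷ b ∷ []) ≡ 0#) → ecl F E B c
  ecl-implicit₂ {a} {b} (m , f , ρ , ρ₀≡a , solf) (k , g , τ , τ₀≡b , solg) =
    ecl-implicit (juxtapose f g) (ρ ++ τ) (solves-++ f ρ g τ solf solg) π (a ∷ b ∷ []) coordinates
    where
    π : Fin 2 → Fin (suc m ℕ.+ suc k)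
    π = (zero ↑ˡ suc k) ∷ (suc m ↑ʳ zero) ∷ []
    coordinates : ∀ i → (ρ ++ τ) (π i) ≡ (a ∷ b ∷ []) i
    coordinates zero       = trans (lookup-++ˡ ρ τ zero) ρ₀≡a
    coordinates (suc zero) = trans (lookup-++ʳ ρ τ zero) τ₀≡b

  x₀ : ∀ {n} → Poly (suc n)
  x₀ = x zero

  x₁ : ∀ {n} → Poly (suc (suc n))
  x₁ = x (suc zero)

  x₂ : ∀ {n} → Poly (suc (suc (suc n)))
  x₂ = x (suc (suc zero))

  ecl-isSubfield : IsSubfield F (ecl F E B)
  ecl-isSubfield = record
    { 0∈   = ecl-implicit₀ x₀ 0# refl 1≢0
    ; 1∈   = ecl-implicit₀ (x₀ ⊖ cst 1# one∈) 1# (+-inverseʳ 1#) (x-y≢0 1≢0 refl)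
    ; +∈   = λ {a} {b} a∈ b∈ → ecl-implicit₂ a∈ b∈ (x₀ ⊖ (x₁ ⊕ x₂)) (a + b)
               (+-inverseʳ (a + b)) (x-y≢0 1≢0 (+-identity 0#))
    ; *∈   = λ {a} {b} a∈ b∈ → ecl-implicit₂ a∈ b∈ (x₀ ⊖ (x₁ ⊗ x₂)) (a * b)
               (+-inverseʳ (a * b)) (x-y≢0 1≢0 (trans (cong₂ _+_ (zeroˡ b) (zeroʳ a)) (+-identity 0#)))
    ; -∈   = λ {a} a∈ → ecl-implicit₁ a∈ (x₁ ⊕ x₀) (- a)
               (+-inverseʳ a) (λ 0+1≡0 → 1≢0 (trans (sym (+-identity 1#)) 0+1≡0))
    ; inv∈ = λ {a} a≢0 a∈ → ecl-implicit₁ a∈ ((x₀ ⊗ x₁) ⊖ cst 1# one∈) (inv a a≢0)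
               (trans (cong (_- 1#) (inv-left a a≢0)) (+-inverseʳ 1#))
               (x-y≢0 (λ ∂≡0 → a≢0 (trans (sym (∂≡a a≢0)) ∂≡0)) refl)
    }
    where
    ∂≡a : ∀ {a} (a≢0 : ¬ (a ≡ 0#)) → 1# * a + inv a a≢0 * 0# ≡ a
    ∂≡a {a} a≢0 = trans (cong₂ _+_ (*-identity a) (zeroʳ (inv a a≢0))) (+-identityʳ a)

  ecl-isExpClosed : IsExponential F E → IsExpClosed F E (ecl F E B)
  ecl-isExpClosed isExp = record
    { E∈     = λ {a} a∈ → ecl-implicit₁ a∈ (x₀ ⊖ exP x₁) (E a)
                 (+-inverseʳ (E a)) (x-y≢0 1≢0 (zeroʳ (E a)))
    ; E-pos  = λ {a} _ → E-pos a
    ; E-hom  = λ {a} {b} _ _ → E-hom a b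
    ; E-mono = λ {a} {b} _ _ → E-mono a b
    ; E-surj = λ {y} y∈ 0<y → let (l , El≡y) = E-surj y 0<y in
        l , ecl-implicit₁ y∈ (exP x₀ ⊖ x₁) l
              (trans (cong (_- y) El≡y) (+-inverseʳ y))
              (x-y≢0 (0<x⇒x≢0 (subst (0# <_) (sym (*-identityʳ (E l))) (E-pos l))) refl)
          , El≡y
    }
    where open IsExponential isExp

lemma2p2 : (F : OrderedField) → (E : OrderedField.K F → OrderedField.K F) →
    IsExponential F E → IsEXP F E → OMinimal F E →
    (B : OrderedField.K F → Set) →
    IsSubfield F (ecl F E B) × IsExpClosed F E (ecl F E B)
lemma2p2 F E isExp _ _ B = ecl-isSubfield , ecl-isExpClosed isExp
  where open ExponentialAlgebraicClosure F E B
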